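{- Let $(U,\mathcal{F})$ be a standard closure system with closure operator $\phi$, and let $\mathcal{F}^b=\{\phi^b(A):A\subseteq U\}$. For $c\in U$, the antichains $$\mathcal{B}^+=\{M\in\mathrm{Mi}(\mathcal{F}): c\uparrow M\}\quad\text{and}\quad \mathcal{B}^-=\{\phi^b(A): A\in\mathrm{gen}_D(c)\}\cup\{\phi^b(\{c\})\}$$ are dual in $(\mathcal{F}^b,\subseteq)$. Moreover, $\phi^b$ is a one-to-one mapping from $\mathrm{gen}_D(c)$ onto $\{\phi^b(A): A\in\mathrm{gen}_D(c)\}$.
   Context: A closure system $(U,\mathcal{F})$ on a finite set $U$: $U\in\mathcal{F}$, closed under intersection; $\phi(A)=\bigcap\{F\in\mathcal{F}:A\subseteq F\}$. Standard: $\phi(\{a\})\setminus\{a\}\in\mathcal{F}$ for all $a$. $\phi^b(A)=\bigcup_{a\in A}\phi(\{a\})$, a closure operator whose closed-set family $\mathcal{F}^b$ is distributive (closed under unions and intersections). $\mathrm{Mi}(\mathcal{F})$: closed $M\neq U$ such that $M=F_1\cap F_2$ with $F_i\in\mathcal{F}$ implies $F_1=M$ or $F_2=M$. For $c\in U$ and $M\in\mathrm{Mi}(\mathcal{F})$, $c\uparrow M$ means $M$ is inclusion-maximal among the members of $\mathrm{Mi}(\mathcal{F})$ not containing $c$. A minimal generator of $c$: $A$ with $c\in\phi(A)$, $c\notin\phi(A')$ for $A'\subsetneq A$. $\mathrm{gen}_D(c)$ is the set of $D$-generators of $c$: minimal generators $A$ of $c$ with $c\notin\phi^b(A)$ such that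 every minimal generator $A'$ of $c$ with $A'\subseteq\phi^b(A)$ equals $A$. Antichains $\mathcal{B}^-,\mathcal{B}^+$ of a poset $(\mathcal{L},\subseteq)$ are dual if every element of $\mathcal{L}$ either contains a member of $\mathcal{B}^-$ or is contained in a member of $\mathcal{B}^+$, but not both. -}

module Defs where

open import Data.Nat using (ℕ; zero; suc)
open import Data.Fin using (Fin)
open import Data.Fin.Subset
  using (Subset; inside; outside; ⊤; ⁅_⁆; _∈_; _∉_; _⊆_; _⊂_; _∩_; _-_; ⋂; ⋃)
open import Data.Fin.Subset.Properties using (_∈?_; _⊆?_)
open import Data.List using (List; []; _∷_; _++_; map; filter)
open import Data.List.Base using (allFin)
open import Data.Vec using ([]; _∷_)
open import Data.Product using (Σ; ∃; _×_; _,_)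
open import Data.Sum using (_⊎_)
open import Relation.Nullary using (¬_)
open import Relation.Nullary.Decidable using (_×-dec_)
open import Relation.Unary using (Decidable)
open import Relation.Binary.PropositionalEquality using (_≡_; _≢_)

allSubsets : (n : ℕ) → List (Subset n)
allSubsets zero    = [] ∷ []
allSubsets (suc n) = map (inside ∷_) (allSubsets n) ++ map (outside ∷_) (allSubsets n)

-- A closure system (U, 𝓕) on the finite set U = Fin n.  The family 𝓕 is
-- given by a (decidable) membership predicate "Closed".
record ClosureSystem (n : ℕ) : Set₁ where
  field
    Closed    : Subset n → Set
    closed?   : Decidable Closed
    top       : Closed ⊤
    ∩-closed  : ∀ F G → Closed F → Closed G → Closed (F ∩ G)

module _ {n : ℕ} (S : ClosureSystem n) where
  open ClosureSystem S

  φ : Subset n → Subset n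
  φ A = ⋂ (filter (λ F → closed? F ×-dec (A ⊆? F)) (allSubsets n))

  φᵇ : Subset n → Subset n
  φᵇ A = ⋃ (map (λ a → φ ⁅ a ⁆) (filter (_∈? A) (allFin n)))

  Standard : Set
  Standard = ∀ (a : Fin n) → Closed (φ ⁅ a ⁆ - a)

  InFb : Subset n → Set
  InFb L = ∃ λ A → L ≡ φᵇ A

  Mi : Subset n → Set
  Mi M = Closed M × M ≢ ⊤ ×
         (∀ F₁ F₂ → Closed F₁ → Closed F₂ → M ≡ F₁ ∩ F₂ → F₁ ≡ M ⊎ F₂ ≡ M)

  _↑_ : Fin n → Subset n → Set
  c ↑ M = Mi M × c ∉ M × (∀ M′ → Mi M′ → c ∉ M′ → M ⊆ M′ → M′ ≡ M)

  MinGen : Fin n → Subset n → Set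
  MinGen c A = c ∈ φ A × (∀ A′ → A′ ⊂ A → c ∉ φ A′)

  GenD : Fin n → Subset n → Set
  GenD c A = MinGen c A × c ∉ φᵇ A × (∀ A′ → MinGen c A′ → A′ ⊆ φᵇ A → A′ ≡ A)

  B⁺ : Fin n → Subset n → Set
  B⁺ c M = c ↑ M

  B⁻ : Fin n → Subset n → Set
  B⁻ c X = (∃ λ A → GenD c A × X ≡ φᵇ A) ⊎ X ≡ φᵇ ⁅ c ⁆

module _ {n : ℕ} where

  Antichain : (Subset n → Set) → (Subset n → Set) → Set
  Antichain L B = (∀ X → B X → L X) × (∀ X Y → B X → B Y → X ⊆ Y → X ≡ Y)

  Dual : (Subset n → Set) → (Subset n → Set) → (Subset n → Set) → Set
  Dual L Bm Bp =
    Antichain L Bm × Antichain L Bp ×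
    (∀ X → L X →
       let P = ∃ λ B → Bm B × B ⊆ X
           Q = ∃ λ B → Bp B × X ⊆ B
       in (P ⊎ Q) × ¬ (P × Q))

-- Standardness makes the preorder "a ∈ φ({b})" antisymmetric, and then a
-- minimal generator A is determined by φᵇ(A): if φᵇ(A) = φᵇ(A′), each a ∈ A
-- lies in φ({a′}) for some a′ ∈ A′ and a′ in φ({a″}) for some a″ ∈ A;
-- minimality of A forces a″ = a, and antisymmetry then a′ = a.
--
-- For duality, let X ∈ 𝓕ᵇ.  If c ∉ φ(X), a maximal closed set above X
-- avoiding c is meet-irreducible, hence a member of 𝓑⁺ above X.  If c ∈ X,
-- then φᵇ({c}) ⊆ X.  Otherwise choose a generator of c inside X whose
-- φᵇ-image is minimal and shrink it to a minimal generator A: any minimal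
-- generator inside φᵇ(A) has the same φᵇ-image, so equals A, making A a
-- D-generator with φᵇ(A) ⊆ X.  Both alternatives cannot hold at once, since
-- every member of 𝓑⁻ generates c while every member of 𝓑⁺ is closed and
-- avoids c.

module Submission where

open import Defs
open import Data.Nat using (ℕ)
open import Data.Fin using (Fin)
open import Data.Fin.Properties using (_≟_)
open import Data.Fin.Subset
  using (Subset; inside; outside; ⊤; ⁅_⁆; _∈_; _∉_; _⊆_; _⊂_; _∩_; _─_; _-_; ⋂; ⋃)
open import Data.Fin.Subset.Properties
  using ( _∈?_; _⊆?_; _⊂?_; ∈⊤; ∉⊥; x∈⁅x⁆; x∈⁅y⁆⇒x≡y; x≢y⇒x∉⁅y⁆; x∈p∧x≢y⇒x∈p-y
        ; x∈p⇒p-x⊂p; ⊆-refl; ⊆-reflexive; ⊆-trans; ⊆-antisym; p∩q⊆p; p∩q⊆q; x∈p∩q⁺; x∈p∩q⁻; x∈p∪q⁺; x∈p∪q⁻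
        ; anySubset? )
open import Data.Fin.Subset.Induction using (⊂-wellFounded; ⊃-wellFounded)
open import Data.List using (List; []; _∷_; map; allFin)
open import Data.List.Membership.Propositional using (lose; find) renaming (_∈_ to _∈ₗ_)
open import Data.List.Membership.Propositional.Properties
  using (∈-filter⁺; ∈-filter⁻; ∈-map⁺; ∈-allFin; ∈-++⁺ˡ; ∈-++⁺ʳ)
open import Data.List.Relation.Unary.All as All using (All; []; _∷_)
open import Data.List.Relation.Unary.All.Properties using (all-filter)
open import Data.List.Relation.Unary.Any as Any using (Any)
import Data.List.Relation.Unary.Any.Properties as Any
open import Data.Vec.Base using ([]; _∷_; here; there)
open import Data.Product using (∃; _×_; _,_; proj₁; proj₂)
open import Data.Sum using (_⊎_; inj₁; inj₂)
open import Data.Empty using (⊥-elim)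
open import Function using (_∘_)
open import Induction.WellFounded using (WellFounded; Acc; acc)
open import Relation.Binary using () renaming (Decidable to Decidable₂)
import Relation.Binary.Construct.On as On
open import Relation.Nullary using (¬_; yes; no; ¬?; contradiction)
open import Relation.Nullary.Decidable using (_×-dec_)
open import Relation.Unary using (Decidable)
open import Relation.Binary.PropositionalEquality using (_≡_; _≢_; refl; sym; trans; cong; subst)

private variable
  n : ℕ
  x : Fin n
  p q : Subset n

x∈p─q⇒x∉q : ∀ (p q : Subset n) → x ∈ p ─ q → x ∉ q
x∈p─q⇒x∉q (inside ∷ p) (outside ∷ q) here      ()
x∈p─q⇒x∉q (_ ∷ p)      (_ ∷ q)       (there m) (there k) = x∈p─q⇒x∉q p q m k

x∈p⇒⁅x⁆⊆p : x ∈ p → ⁅ x ⁆ ⊆ p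
x∈p⇒⁅x⁆⊆p {x = x} x∈p y∈⁅x⁆ = subst (_∈ _) (sym (x∈⁅y⁆⇒x≡y x y∈⁅x⁆)) x∈p

p⊆q∧p⊄q⇒p≡q : p ⊆ q → ¬ p ⊂ q → p ≡ q
p⊆q∧p⊄q⇒p≡q {p = p} p⊆q p⊄q = ⊆-antisym p⊆q q⊆p
  where
  q⊆p : _ ⊆ p
  q⊆p {x} x∈q with x ∈? p
  ... | yes x∈p = x∈p
  ... | no  x∉p = contradiction ((λ {y} → p⊆q {y}) , x , x∈q , x∉p) p⊄q

x∈⋂⁺ : ∀ {Fs : List (Subset n)} → All (x ∈_) Fs → x ∈ ⋂ Fs
x∈⋂⁺ []             = ∈⊤
x∈⋂⁺ (x∈F ∷ x∈Fs) = x∈p∩q⁺ (x∈F , x∈⋂⁺ x∈Fs)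

x∈⋂⁻ : ∀ (Fs : List (Subset n)) → x ∈ ⋂ Fs → All (x ∈_) Fs
x∈⋂⁻ []       _   = []
x∈⋂⁻ (F ∷ Fs) x∈⋂ with x∈p∩q⁻ F (⋂ Fs) x∈⋂
... | x∈F , x∈⋂Fs = x∈F ∷ x∈⋂⁻ Fs x∈⋂Fs

x∈⋃⁺ : ∀ {Fs : List (Subset n)} → Any (x ∈_) Fs → x ∈ ⋃ Fs
x∈⋃⁺ (Any.here x∈F)   = x∈p∪q⁺ (inj₁ x∈F)
x∈⋃⁺ (Any.there x∈Fs) = x∈p∪q⁺ (inj₂ (x∈⋃⁺ x∈Fs))

x∈⋃⁻ : ∀ (Fs : List (Subset n)) → x ∈ ⋃ Fs → Any (x ∈_) Fs
x∈⋃⁻ []       x∈⋃ = contradiction x∈⋃ ∉⊥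
x∈⋃⁻ (F ∷ Fs) x∈⋃ with x∈p∪q⁻ F (⋃ Fs) x∈⋃
... | inj₁ x∈F  = Any.here x∈F
... | inj₂ x∈⋃Fs = Any.there (x∈⋃⁻ Fs x∈⋃Fs)

∈-allSubsets : ∀ (p : Subset n) → p ∈ₗ allSubsets n
∈-allSubsets []            = Any.here refl
∈-allSubsets (inside ∷ p)  = ∈-++⁺ˡ (∈-map⁺ (inside ∷_) (∈-allSubsets p))
∈-allSubsets {n = ℕ.suc n} (outside ∷ p) =
  ∈-++⁺ʳ (map (inside ∷_) (allSubsets n)) (∈-map⁺ (outside ∷_) (∈-allSubsets p))

module _ {P : Subset n → Set} (P? : Decidable P)
         {_<_ : Subset n → Subset n → Set} (<-wf : WellFounded _<_) (_<?_ : Decidable₂ _<_) where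

  wf-minimal : ∀ {A} → P A → ∃ λ B → P B × ∀ {B′} → P B′ → ¬ B′ < B
  wf-minimal {A} = go (<-wf A)
    where
    go : ∀ {A} → Acc _<_ A → P A → ∃ λ B → P B × ∀ {B′} → P B′ → ¬ B′ < B
    go {A} (acc rs) pA with anySubset? (λ B → P? B ×-dec (B <? A))
    ... | yes (B , pB , B<A) = go (rs B<A) pB
    ... | no  ∄smaller       = A , pA , λ pB′ B′<A → ∄smaller (_ , pB′ , B′<A)

module _ {n : ℕ} (S : ClosureSystem n) where
  open ClosureSystem S

  private variable
    A B X : Subset n
    a b c : Fin n

  ⋂-closed : ∀ {Fs} → All Closed Fs → Closed (⋂ Fs)
  ⋂-closed []         = top
  ⋂-closed (cF ∷ cFs) = ∩-closed _ _ cF (⋂-closed cFs)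

  φ-closed : ∀ A → Closed (φ S A)
  φ-closed A = ⋂-closed (All.map proj₁ (all-filter _ (allSubsets n)))

  φ-extensive : A ⊆ φ S A
  φ-extensive x∈A = x∈⋂⁺ (All.map (λ (_ , A⊆F) → A⊆F x∈A) (all-filter _ (allSubsets n)))

  φ-least : ∀ {F} → Closed F → A ⊆ F → φ S A ⊆ F
  φ-least {A} {F} cF A⊆F x∈φA =
    All.lookup (x∈⋂⁻ _ x∈φA) (∈-filter⁺ (λ G → closed? G ×-dec (A ⊆? G)) (∈-allSubsets F) (cF , A⊆F))

  φ-mono : A ⊆ B → φ S A ⊆ φ S B
  φ-mono {B = B} A⊆B = φ-least (φ-closed B) (⊆-trans A⊆B φ-extensive)

  b∈φ⁅a⁆⇒φ⁅b⁆⊆φ⁅a⁆ : b ∈ φ S ⁅ a ⁆ → φ S ⁅ b ⁆ ⊆ φ S ⁅ a ⁆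
  b∈φ⁅a⁆⇒φ⁅b⁆⊆φ⁅a⁆ {a = a} b∈ = φ-least (φ-closed ⁅ a ⁆) (x∈p⇒⁅x⁆⊆p b∈)

  ∈-φᵇ⁺ : a ∈ A → x ∈ φ S ⁅ a ⁆ → x ∈ φᵇ S A
  ∈-φᵇ⁺ {a = a} {A} a∈A x∈ = x∈⋃⁺ (Any.map⁺ (lose (∈-filter⁺ (_∈? A) (∈-allFin a) a∈A) x∈))

  ∈-φᵇ⁻ : x ∈ φᵇ S A → ∃ λ a → a ∈ A × x ∈ φ S ⁅ a ⁆
  ∈-φᵇ⁻ {A = A} x∈ with find (Any.map⁻ (x∈⋃⁻ _ x∈))
  ... | a , a∈ , x∈φ⁅a⁆ = a , proj₂ (∈-filter⁻ (_∈? A) {xs = allFin n} a∈) , x∈φ⁅a⁆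

  φᵇ-extensive : A ⊆ φᵇ S A
  φᵇ-extensive {x = a} a∈A = ∈-φᵇ⁺ a∈A (φ-extensive (x∈⁅x⁆ a))

  φᵇ-mono : A ⊆ B → φᵇ S A ⊆ φᵇ S B
  φᵇ-mono A⊆B x∈ with ∈-φᵇ⁻ x∈
  ... | a , a∈A , x∈φ⁅a⁆ = ∈-φᵇ⁺ (A⊆B a∈A) x∈φ⁅a⁆

  φᵇ-idempotent : φᵇ S (φᵇ S A) ⊆ φᵇ S A
  φᵇ-idempotent x∈ with ∈-φᵇ⁻ x∈
  ... | a , a∈φᵇA , x∈φ⁅a⁆ with ∈-φᵇ⁻ a∈φᵇA
  ...   | b , b∈A , a∈φ⁅b⁆ = ∈-φᵇ⁺ b∈A (b∈φ⁅a⁆⇒φ⁅b⁆⊆φ⁅a⁆ a∈φ⁅b⁆ x∈φ⁅a⁆)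

  φᵇ⊆φ : φᵇ S A ⊆ φ S A
  φᵇ⊆φ x∈ with ∈-φᵇ⁻ x∈
  ... | a , a∈A , x∈φ⁅a⁆ = φ-mono (x∈p⇒⁅x⁆⊆p a∈A) x∈φ⁅a⁆

  closed⇒φᵇ-fixed : Closed A → φᵇ S A ≡ A
  closed⇒φᵇ-fixed cA = ⊆-antisym (φ-least cA ⊆-refl ∘ φᵇ⊆φ) φᵇ-extensive

  minGen-irredundant : MinGen S c A → a ∈ A → b ∈ A → a ∈ φ S ⁅ b ⁆ → a ≡ b
  minGen-irredundant {c} {A} {a} {b} (c∈φA , minimal) a∈A b∈A a∈φ⁅b⁆ with a ≟ b
  ... | yes a≡b = a≡b
  ... | no  a≢b = contradiction (φ-least (φ-closed (A - a)) A⊆φ[A-a] c∈φA) (minimal (A - a) (x∈p⇒p-x⊂p a∈A))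
    where
    A⊆φ[A-a] : A ⊆ φ S (A - a)
    A⊆φ[A-a] {x} x∈A with x ≟ a
    ... | yes refl = φ-mono (x∈p⇒⁅x⁆⊆p (x∈p∧x≢y⇒x∈p-y b∈A (a≢b ∘ sym))) a∈φ⁅b⁆
    ... | no  x≢a  = φ-extensive (x∈p∧x≢y⇒x∈p-y x∈A x≢a)

  ∃-minGen-⊆ : c ∈ φ S A → ∃ λ B → MinGen S c B × B ⊆ A
  ∃-minGen-⊆ {c} {A} c∈φA
    with wf-minimal (λ B → (c ∈? φ S B) ×-dec (B ⊆? A)) ⊂-wellFounded _⊂?_ (c∈φA , ⊆-refl)
  ... | B , (c∈φB , B⊆A) , minimal =
    B , (c∈φB , λ B′ B′⊂B c∈φB′ → minimal (c∈φB′ , ⊆-trans (proj₁ B′⊂B) B⊆A) B′⊂B) , B⊆A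

  maximal-avoiding⇒↑ : ∀ {M} → Closed M → c ∉ M →
                       (∀ {G} → Closed G → c ∉ G → M ⊆ G → G ≡ M) → _↑_ S c M
  maximal-avoiding⇒↑ {c} {M} cM c∉M maximal =
    (cM , M≢⊤ , irreducible) , c∉M , λ _ (cM′ , _) c∉M′ M⊆M′ → maximal cM′ c∉M′ M⊆M′
    where
    M≢⊤ : M ≢ ⊤
    M≢⊤ refl = c∉M ∈⊤
    irreducible : ∀ F₁ F₂ → Closed F₁ → Closed F₂ → M ≡ F₁ ∩ F₂ → F₁ ≡ M ⊎ F₂ ≡ M
    irreducible F₁ F₂ cF₁ cF₂ M≡F₁∩F₂ with c ∈? F₁ | c ∈? F₂
    ... | no c∉F₁  | _        = inj₁ (maximal cF₁ c∉F₁ (p∩q⊆p F₁ F₂ ∘ ⊆-reflexive M≡F₁∩F₂))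
    ... | yes _    | no c∉F₂  = inj₂ (maximal cF₂ c∉F₂ (p∩q⊆q F₁ F₂ ∘ ⊆-reflexive M≡F₁∩F₂))
    ... | yes c∈F₁ | yes c∈F₂ = contradiction (⊆-reflexive (sym M≡F₁∩F₂) (x∈p∩q⁺ (c∈F₁ , c∈F₂))) c∉M

  ∃-↑-above : Closed X → c ∉ X → ∃ λ M → _↑_ S c M × X ⊆ M
  ∃-↑-above {X} {c} cX c∉X
    with wf-minimal (λ F → closed? F ×-dec ((X ⊆? F) ×-dec ¬? (c ∈? F)))
                    ⊃-wellFounded (λ F′ F → F ⊂? F′) (cX , ⊆-refl , c∉X)
  ... | M , (cM , X⊆M , c∉M) , maximal = M , maximal-avoiding⇒↑ cM c∉M M-maximal , X⊆M
    where
    M-maximal : ∀ {G} → Closed G → c ∉ G → M ⊆ G → G ≡ M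
    M-maximal cG c∉G M⊆G = sym (p⊆q∧p⊄q⇒p≡q M⊆G (maximal (cG , ⊆-trans X⊆M M⊆G , c∉G)))

  module _ (c : Fin n) where

    c∈φᵇ⁅c⁆ : c ∈ φᵇ S ⁅ c ⁆
    c∈φᵇ⁅c⁆ = φᵇ-extensive (x∈⁅x⁆ c)

    B⁺-antichain : Antichain (InFb S) (B⁺ S c)
    B⁺-antichain = (λ { X ((cX , _) , _) → X , sym (closed⇒φᵇ-fixed cX) })
                 , (λ { _ Y (_ , _ , maximal) (miY , c∉Y , _) X⊆Y → sym (maximal Y miY c∉Y X⊆Y) })

    B⁻⇒c∈φ : B⁻ S c X → c ∈ φ S X
    B⁻⇒c∈φ (inj₁ (_ , ((c∈φA , _) , _) , refl)) = φ-mono φᵇ-extensive c∈φA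
    B⁻⇒c∈φ (inj₂ refl)                          = φ-extensive c∈φᵇ⁅c⁆

    ¬B⁻-below-and-B⁺-above : ¬ ((∃ λ B → B⁻ S c B × B ⊆ X) × (∃ λ M → B⁺ S c M × X ⊆ M))
    ¬B⁻-below-and-B⁺-above ((_ , B∈B⁻ , B⊆X) , (_ , ((cM , _) , c∉M , _) , X⊆M)) =
      c∉M (φ-least cM (⊆-trans B⊆X X⊆M) (B⁻⇒c∈φ B∈B⁻))

  module _ (std : Standard S) where

    A⊆φ⁅a⁆∧a∉A⇒a∉φA : A ⊆ φ S ⁅ a ⁆ → a ∉ A → a ∉ φ S A
    A⊆φ⁅a⁆∧a∉A⇒a∉φA {A} {a} A⊆φ⁅a⁆ a∉A a∈φA =
      x∈p─q⇒x∉q (φ S ⁅ a ⁆) ⁅ a ⁆ (φ-least (std a) A⊆φ⁅a⁆-a a∈φA) (x∈⁅x⁆ a)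
      where
      A⊆φ⁅a⁆-a : A ⊆ φ S ⁅ a ⁆ - a
      A⊆φ⁅a⁆-a x∈A = x∈p∧x≢y⇒x∈p-y (A⊆φ⁅a⁆ x∈A) (λ { refl → a∉A x∈A })

    φ⁅⁆-antisym : a ∈ φ S ⁅ b ⁆ → b ∈ φ S ⁅ a ⁆ → a ≡ b
    φ⁅⁆-antisym {a} {b} a∈φ⁅b⁆ b∈φ⁅a⁆ with a ≟ b
    ... | yes a≡b = a≡b
    ... | no  a≢b = contradiction a∈φ⁅b⁆ (A⊆φ⁅a⁆∧a∉A⇒a∉φA (x∈p⇒⁅x⁆⊆p b∈φ⁅a⁆) (x≢y⇒x∉⁅y⁆ a≢b))

    minGen-⊆ : MinGen S c A → φᵇ S A ≡ φᵇ S B → A ⊆ B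
    minGen-⊆ {B = B} genA φᵇA≡φᵇB {a} a∈A
      with ∈-φᵇ⁻ (subst (a ∈_) φᵇA≡φᵇB (φᵇ-extensive a∈A))
    ... | b , b∈B , a∈φ⁅b⁆ with ∈-φᵇ⁻ (subst (b ∈_) (sym φᵇA≡φᵇB) (φᵇ-extensive b∈B))
    ...   | a′ , a′∈A , b∈φ⁅a′⁆
      with minGen-irredundant genA a∈A a′∈A (b∈φ⁅a⁆⇒φ⁅b⁆⊆φ⁅a⁆ b∈φ⁅a′⁆ a∈φ⁅b⁆)
    ...     | refl = subst (_∈ B) (sym (φ⁅⁆-antisym a∈φ⁅b⁆ b∈φ⁅a′⁆)) b∈B

    minGen-φᵇ-injective : MinGen S c A → MinGen S c B → φᵇ S A ≡ φᵇ S B → A ≡ B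
    minGen-φᵇ-injective genA genB φᵇA≡φᵇB =
      ⊆-antisym (minGen-⊆ genA φᵇA≡φᵇB) (minGen-⊆ genB (sym φᵇA≡φᵇB))

    ∃-genD-below : φᵇ S X ⊆ X → c ∈ φ S X → c ∉ X → ∃ λ A → GenD S c A × φᵇ S A ⊆ X
    ∃-genD-below {X} {c} φᵇX⊆X c∈φX c∉X
      with wf-minimal (λ B → (c ∈? φ S B) ×-dec (B ⊆? X)) (On.wellFounded (φᵇ S) ⊂-wellFounded)
                      (λ B′ B → φᵇ S B′ ⊂? φᵇ S B) (c∈φX , ⊆-refl)
    ... | B , (c∈φB , B⊆X) , φᵇB-minimal with ∃-minGen-⊆ c∈φB
    ... | A , genA , A⊆B = A , (genA , c∉X ∘ φᵇA⊆X , unique) , φᵇA⊆X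
      where
      φᵇA⊆X : φᵇ S A ⊆ X
      φᵇA⊆X = φᵇX⊆X ∘ φᵇ-mono (⊆-trans A⊆B B⊆X)
      φᵇ≡φᵇB : ∀ {A′} → c ∈ φ S A′ → φᵇ S A′ ⊆ φᵇ S B → φᵇ S A′ ≡ φᵇ S B
      φᵇ≡φᵇB c∈φA′ φᵇA′⊆φᵇB = p⊆q∧p⊄q⇒p≡q φᵇA′⊆φᵇB
        (φᵇB-minimal (c∈φA′ , φᵇX⊆X ∘ φᵇ-mono B⊆X ∘ φᵇA′⊆φᵇB ∘ φᵇ-extensive))
      unique : ∀ A′ → MinGen S c A′ → A′ ⊆ φᵇ S A → A′ ≡ A
      unique A′ genA′ A′⊆φᵇA = minGen-φᵇ-injective genA′ genA
        (trans (φᵇ≡φᵇB (proj₁ genA′) (φᵇ-mono A⊆B ∘ φᵇ-idempotent ∘ φᵇ-mono A′⊆φᵇA))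
               (sym (φᵇ≡φᵇB (proj₁ genA) (φᵇ-mono A⊆B))))

    module _ (c : Fin n) where

      genD⇒φᵇ⊈φᵇ⁅c⁆ : GenD S c A → ¬ φᵇ S A ⊆ φᵇ S ⁅ c ⁆
      genD⇒φᵇ⊈φᵇ⁅c⁆ ((c∈φA , _) , c∉φᵇA , _) φᵇA⊆φᵇ⁅c⁆ =
        A⊆φ⁅a⁆∧a∉A⇒a∉φA (φᵇ⊆φ ∘ φᵇA⊆φᵇ⁅c⁆ ∘ φᵇ-extensive) (c∉φᵇA ∘ φᵇ-extensive) c∈φA

      B⁻-antichain : Antichain (InFb S) (B⁻ S c)
      B⁻-antichain = in-𝓕ᵇ , incomparable
        where
        in-𝓕ᵇ : ∀ X → B⁻ S c X → InFb S X
        in-𝓕ᵇ _ (inj₁ (A , _ , X≡φᵇA)) = A , X≡φᵇA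
        in-𝓕ᵇ _ (inj₂ X≡φᵇ⁅c⁆)         = ⁅ c ⁆ , X≡φᵇ⁅c⁆
        incomparable : ∀ X Y → B⁻ S c X → B⁻ S c Y → X ⊆ Y → X ≡ Y
        incomparable _ _ (inj₁ (A , genA , refl)) (inj₁ (_ , (_ , _ , unique) , refl)) X⊆Y =
          cong (φᵇ S) (unique A (proj₁ genA) (X⊆Y ∘ φᵇ-extensive))
        incomparable _ _ (inj₁ (_ , genA , refl)) (inj₂ refl) X⊆Y = ⊥-elim (genD⇒φᵇ⊈φᵇ⁅c⁆ genA X⊆Y)
        incomparable _ _ (inj₂ refl) (inj₁ (_ , (_ , c∉φᵇA , _) , refl)) X⊆Y = ⊥-elim (c∉φᵇA (X⊆Y (c∈φᵇ⁅c⁆ c)))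
        incomparable _ _ (inj₂ refl) (inj₂ refl) _ = refl

      B⁻-below-or-B⁺-above : φᵇ S X ⊆ X → (∃ λ B → B⁻ S c B × B ⊆ X) ⊎ (∃ λ M → B⁺ S c M × X ⊆ M)
      B⁻-below-or-B⁺-above {X} φᵇX⊆X with c ∈? φ S X | c ∈? X
      ... | no c∉φX | _ = let M , c↑M , φX⊆M = ∃-↑-above (φ-closed X) c∉φX
                          in inj₂ (M , c↑M , λ x∈X → φX⊆M (φ-extensive x∈X))
      ... | yes _ | yes c∈X =
        inj₁ (φᵇ S ⁅ c ⁆ , inj₂ refl , λ x∈ → φᵇX⊆X (φᵇ-mono (x∈p⇒⁅x⁆⊆p c∈X) x∈))
      ... | yes c∈φX | no c∉X = let A , genA , φᵇA⊆X = ∃-genD-below φᵇX⊆X c∈φX c∉X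
                                in inj₁ (φᵇ S A , inj₁ (A , genA , refl) , φᵇA⊆X)

      B⁻-B⁺-dual : Dual (InFb S) (B⁻ S c) (B⁺ S c)
      B⁻-B⁺-dual = B⁻-antichain , B⁺-antichain c , λ { _ (Y , refl) →
        B⁻-below-or-B⁺-above φᵇ-idempotent , ¬B⁻-below-and-B⁺-above c }

lemma3 : ∀ {n : ℕ} (S : ClosureSystem n) → Standard S → (c : Fin n) →
         Dual (InFb S) (B⁻ S c) (B⁺ S c) ×
         (∀ A A′ → GenD S c A → GenD S c A′ → φᵇ S A ≡ φᵇ S A′ → A ≡ A′)
lemma3 S std c =
  B⁻-B⁺-dual S std c , λ _ _ genA genA′ → minGen-φᵇ-injective S std (proj₁ genA) (proj₁ genA′)
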